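{- Let $a,b,c,d,e$ be positive integers, not all even, such that $a+c+e$ and $b+d$ are both even. Then the word $W=\mathtt1^a\mathtt0^b\mathtt1^c\mathtt0^d\mathtt1^e$ is a shuffle square if and only if at least one of the following holds: (i) $b=d$ and $c\leqslant a+e$; (ii) $b\leqslant d$, $a\geqslant c$, and $e$ is even; (iii) $b\geqslant d$, $c\leqslant e$, and $a$ is even.
   Context: $w^r$ denotes $r$ consecutive copies of the letter $w$. A word $W$ is a shuffle square if its positions can be partitioned into the supports of two subsequences that are equal as words. -}

module Defs where

open import Data.Nat using (ℕ)
open import Data.List using (List; replicate; _++_)
open import Data.Product using (∃)
open import Data.Nat.Divisibility using (_∣_)
open import Data.List.Relation.Ternary.Interleaving.Propositional using (Interleaving)

Word : Set
Word = List ℕ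

-- W is a shuffle square: its positions split into the supports of two
-- subsequences equal to the same word u, i.e. W is an interleaving of u with u.
IsShuffleSquare : Word → Set
IsShuffleSquare W = ∃ λ (u : Word) → Interleaving u u W

_^ʷ_ : ℕ → ℕ → Word
w ^ʷ r = replicate r w

W₁₀₁₀₁ : ℕ → ℕ → ℕ → ℕ → ℕ → Word
W₁₀₁₀₁ a b c d e = (1 ^ʷ a) ++ (0 ^ʷ b) ++ (1 ^ʷ c) ++ (0 ^ʷ d) ++ (1 ^ʷ e)

Even : ℕ → Set
Even n = 2 ∣ n

-- An interleaving of u with u that yields W = 1^a 0^b 1^c 0^d 1^e cuts each copy of u into five
-- (possibly empty) blocks 1^α 0^β 1^γ 0^δ 1^ε, so W is a shuffle square iff (a, b, c, d, e) is
-- a sum x + y of two block vectors spelling the same word. If the three inner blocks of x are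
-- nonempty, the word determines x, hence x = y and a, b, c, d, e are all even. Otherwise x
-- spells 1^p 0^q 1^r with its β-, γ- or δ-block empty, and then so does y; since b, c, d > 0
-- the empty blocks of x and y differ, and the pairs {β, δ}, {β, γ}, {γ, δ} of empty blocks
-- give (i), (ii), (iii) respectively. Conversely each condition is realised by such a pair; for
-- (i) the middle block is split as c = γ₁ + γ₂ with a − γ₁ and e − γ₂ even, which the parity
-- of a + c + e and c > 0 allow.
module Submission where

open import Defs
open import Data.Nat using (ℕ; zero; suc; _+_; _*_; _∸_; _≤_; _≥_; z≤n; s≤s; _≤?_)
open import Data.Nat.Properties
  using ( +-identityʳ; +-comm; +-assoc; +-suc; *-comm; ≤-refl; ≤-trans; ≤-reflexive; n≤1+n
        ; m≤m+n; m≤n+m; m≤n⇒m≤o+n; m≤n⇒m≤n+o; +-mono-≤; m+[n∸m]≡n; m≤n+o⇒m∸n≤o; ≰⇒≥ )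
open import Data.Nat.Divisibility using (divides; ∣m+n∣m⇒∣n)
open import Data.Nat.Tactic.RingSolver using (solve-∀)
open import Data.List using (List; []; _∷_; _++_; replicate; head; length)
open import Data.List.Properties using (++-assoc; ++-identityʳ; ∷-injectiveʳ; length-replicate)
open import Data.List.Relation.Ternary.Interleaving.Propositional
  using (Interleaving; consˡ; consʳ; [])
open import Data.List.Relation.Ternary.Interleaving.Properties using (++⁺)
open import Data.Maybe using (just)
open import Data.Maybe.Properties using (just-injective)
open import Data.Product using (_×_; _,_; ∃₂; ∃-syntax; map₁)
open import Data.Sum using (_⊎_; inj₁; inj₂)
open import Data.Empty using (⊥-elim)
open import Function using (_∘_)
open import Function.Bundles using (_⇔_; mk⇔; Equivalence)
open import Relation.Nullary using (¬_; yes; no)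
open import Relation.Binary.PropositionalEquality
  using (_≡_; _≢_; refl; sym; trans; cong; subst; subst₂; module ≡-Reasoning)

replicate-+ : ∀ {A : Set} m n (x : A) → replicate (m + n) x ≡ replicate m x ++ replicate n x
replicate-+ zero    n x = refl
replicate-+ (suc m) n x = cong (x ∷_) (replicate-+ m n x)

module _ {A : Set} {x : A} where

  replicate-injective : ∀ m n → replicate m x ≡ replicate n x → m ≡ n
  replicate-injective m n eq =
    trans (sym (length-replicate m)) (trans (cong length eq) (length-replicate n))

  head-replicate≢ : ∀ {y} n → y ≢ x → head (replicate n y) ≢ just x
  head-replicate≢ zero    y≢x ()
  head-replicate≢ (suc n) y≢x = y≢x ∘ just-injective

  replicate-++-injective : ∀ m n {xs ys} → head xs ≢ just x → head ys ≢ just x →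
                           replicate m x ++ xs ≡ replicate n x ++ ys → m ≡ n × xs ≡ ys
  replicate-++-injective zero    zero    _   _   eq = refl , eq
  replicate-++-injective zero    (suc n) xs≢ _   eq = ⊥-elim (xs≢ (cong head eq))
  replicate-++-injective (suc m) zero    _   ys≢ eq = ⊥-elim (ys≢ (cong head (sym eq)))
  replicate-++-injective (suc m) (suc n) xs≢ ys≢ eq =
    map₁ (cong suc) (replicate-++-injective m n xs≢ ys≢ (∷-injectiveʳ eq))

  replicate-++-∷≢replicate : ∀ m n {y xs} → y ≢ x → replicate m x ++ y ∷ xs ≢ replicate n x
  replicate-++-∷≢replicate m n y≢x eq
    with replicate-++-injective m n (y≢x ∘ just-injective) (λ ())
           (trans eq (sym (++-identityʳ (replicate n x))))
  ... | _ , ()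

module _ {A : Set} where

  data Split++ (xs ys : List A) : List A → List A → Set where
    _++ˢ_ : ∀ {l₁ r₁ l₂ r₂} → Interleaving l₁ r₁ xs → Interleaving l₂ r₂ ys →
            Split++ xs ys (l₁ ++ l₂) (r₁ ++ r₂)

  ++⁻ : ∀ xs {ys l r} → Interleaving l r (xs ++ ys) → Split++ xs ys l r
  ++⁻ []       sp = [] ++ˢ sp
  ++⁻ (x ∷ xs) (consˡ sp) with ++⁻ xs sp
  ... | sp₁ ++ˢ sp₂ = consˡ sp₁ ++ˢ sp₂
  ++⁻ (x ∷ xs) (consʳ sp) with ++⁻ xs sp
  ... | sp₁ ++ˢ sp₂ = consʳ sp₁ ++ˢ sp₂

  data SplitReplicate (x : A) : ℕ → List A → List A → Set where
    replicates : ∀ i j → SplitReplicate x (i + j) (replicate i x) (replicate j x)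

  replicate⁻ : ∀ n {x l r} → Interleaving l r (replicate n x) → SplitReplicate x n l r
  replicate⁻ zero    [] = replicates 0 0
  replicate⁻ (suc n) (consˡ sp) with replicate⁻ n sp
  ... | replicates i j = replicates (suc i) j
  replicate⁻ (suc n) {x} (consʳ sp) with replicate⁻ n sp
  ... | replicates i j =
    subst (λ m → SplitReplicate x m (replicate i x) (replicate (suc j) x)) (+-suc i j)
          (replicates i (suc j))

  replicate⁺ : ∀ (x : A) i j → Interleaving (replicate i x) (replicate j x) (replicate (i + j) x)
  replicate⁺ x zero    zero    = []
  replicate⁺ x zero    (suc j) = consʳ (replicate⁺ x zero j)
  replicate⁺ x (suc i) j       = consˡ (replicate⁺ x i j)

record Blocks : Set where
  constructor ⟨_,_,_,_,_⟩
  field α β γ δ ε : ℕ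

word : Blocks → Word
word ⟨ α , β , γ , δ , ε ⟩ = W₁₀₁₀₁ α β γ δ ε

_⊕_ : Blocks → Blocks → Blocks
⟨ α , β , γ , δ , ε ⟩ ⊕ ⟨ α′ , β′ , γ′ , δ′ , ε′ ⟩ =
  ⟨ α + α′ , β + β′ , γ + γ′ , δ + δ′ , ε + ε′ ⟩

⊕-comm : ∀ x y → x ⊕ y ≡ y ⊕ x
⊕-comm ⟨ α , β , γ , δ , ε ⟩ ⟨ α′ , β′ , γ′ , δ′ , ε′ ⟩
  rewrite +-comm α α′ | +-comm β β′ | +-comm γ γ′ | +-comm δ δ′ | +-comm ε ε′ = refl

⟨⟩-cong : ∀ {a b c d e a′ b′ c′ d′ e′} → a ≡ a′ → b ≡ b′ → c ≡ c′ → d ≡ d′ → e ≡ e′ →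
          ⟨ a , b , c , d , e ⟩ ≡ ⟨ a′ , b′ , c′ , d′ , e′ ⟩
⟨⟩-cong refl refl refl refl refl = refl

interleaving-word⁻ : ∀ s {l r} → Interleaving l r (word s) →
                     ∃₂ λ x y → x ⊕ y ≡ s × l ≡ word x × r ≡ word y
interleaving-word⁻ ⟨ a , b , c , d , e ⟩ sp with ++⁻ (1 ^ʷ a) sp
... | sp₁ ++ˢ sp₂ with replicate⁻ a sp₁ | ++⁻ (0 ^ʷ b) sp₂
... | replicates α₁ α₂ | sp₃ ++ˢ sp₄ with replicate⁻ b sp₃ | ++⁻ (1 ^ʷ c) sp₄
... | replicates β₁ β₂ | sp₅ ++ˢ sp₆ with replicate⁻ c sp₅ | ++⁻ (0 ^ʷ d) sp₆
... | replicates γ₁ γ₂ | sp₇ ++ˢ sp₈ with replicate⁻ d sp₇ | replicate⁻ e sp₈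
... | replicates δ₁ δ₂ | replicates ε₁ ε₂ =
  ⟨ α₁ , β₁ , γ₁ , δ₁ , ε₁ ⟩ , ⟨ α₂ , β₂ , γ₂ , δ₂ , ε₂ ⟩ , refl , refl , refl

interleaving-word⁺ : ∀ x y → Interleaving (word x) (word y) (word (x ⊕ y))
interleaving-word⁺ ⟨ α , β , γ , δ , ε ⟩ ⟨ α′ , β′ , γ′ , δ′ , ε′ ⟩ =
  ++⁺ (replicate⁺ 1 α α′) (++⁺ (replicate⁺ 0 β β′) (++⁺ (replicate⁺ 1 γ γ′)
    (++⁺ (replicate⁺ 0 δ δ′) (replicate⁺ 1 ε ε′))))

EqualSplit : Blocks → Set
EqualSplit s = ∃₂ λ x y → x ⊕ y ≡ s × word x ≡ word y

shuffle-square⇔equal-split : ∀ s → IsShuffleSquare (word s) ⇔ EqualSplit s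
shuffle-square⇔equal-split s = mk⇔ to from
  where
    to : IsShuffleSquare (word s) → EqualSplit s
    to (u , sp) with interleaving-word⁻ s sp
    ... | x , y , x⊕y≡s , u≡x , u≡y = x , y , x⊕y≡s , trans (sym u≡x) u≡y

    from : EqualSplit s → IsShuffleSquare (word s)
    from (x , y , x⊕y≡s , eq) =
      word x , subst₂ (Interleaving (word x)) (sym eq) (cong word x⊕y≡s) (interleaving-word⁺ x y)

W₁₀₁ : ℕ → ℕ → ℕ → Word
W₁₀₁ p q r = (1 ^ʷ p) ++ (0 ^ʷ q) ++ (1 ^ʷ r)

W₁₀₁-zero : ∀ p r → W₁₀₁ p 0 r ≡ 1 ^ʷ (p + r)
W₁₀₁-zero p r = sym (replicate-+ p r 1)

W₁₀₁-injective : ∀ {p q r p′ q′ r′} → 1 ≤ q + q′ → W₁₀₁ p q r ≡ W₁₀₁ p′ q′ r′ →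
                 p ≡ p′ × q ≡ q′ × r ≡ r′
W₁₀₁-injective {q = zero} {q′ = zero} ()
W₁₀₁-injective {p} {suc q} {r} {p′} {zero} {r′} _ eq =
  ⊥-elim (replicate-++-∷≢replicate p (p′ + r′) (λ ()) (trans eq (W₁₀₁-zero p′ r′)))
W₁₀₁-injective {p} {zero} {r} {p′} {suc q′} {r′} _ eq =
  ⊥-elim (replicate-++-∷≢replicate p′ (p + r) (λ ()) (trans (sym eq) (W₁₀₁-zero p r)))
W₁₀₁-injective {p} {suc q} {r} {p′} {suc q′} {r′} _ eq
  with replicate-++-injective p p′ (λ ()) (λ ()) eq
... | refl , eq₁ with replicate-++-injective (suc q) (suc q′)
                        (head-replicate≢ r (λ ())) (head-replicate≢ r′ (λ ())) eq₁
... | refl , eq₂ = refl , refl , replicate-injective r r′ eq₂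

data Proper : Blocks → Set where
  proper : ∀ {α β γ δ ε} → Proper ⟨ α , suc β , suc γ , suc δ , ε ⟩

proper-injective : ∀ {x y} → Proper x → Proper y → word x ≡ word y → x ≡ y
proper-injective (proper {α} {β} {γ} {δ} {ε}) (proper {α′} {β′} {γ′} {δ′} {ε′}) eq
  with replicate-++-injective α α′ (λ ()) (λ ()) eq
... | refl , eq₁ with replicate-++-injective (suc β) (suc β′) (λ ()) (λ ()) eq₁
... | refl , eq₂ with replicate-++-injective (suc γ) (suc γ′) (λ ()) (λ ()) eq₂
... | refl , eq₃ with replicate-++-injective (suc δ) (suc δ′)
                        (head-replicate≢ ε (λ ())) (head-replicate≢ ε′ (λ ())) eq₃
... | refl , eq₄ with replicate-injective ε ε′ eq₄
... | refl = refl

proper≢W₁₀₁ : ∀ {x} → Proper x → ∀ p q r → word x ≢ W₁₀₁ p q r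
proper≢W₁₀₁ (proper {α}) p zero r eq =
  replicate-++-∷≢replicate α (p + r) (λ ()) (trans eq (W₁₀₁-zero p r))
proper≢W₁₀₁ (proper {α} {β} {γ}) p (suc q) r eq
  with replicate-++-injective α p (λ ()) (λ ()) eq
... | _ , eq₁ with replicate-++-injective (suc β) (suc q) (λ ()) (head-replicate≢ r (λ ())) eq₁
... | _ , eq₂ = replicate-++-∷≢replicate (suc γ) r (λ ()) eq₂

-- An empty inner block of x merges its neighbours, so that x spells 1^p 0^q 1^r.
data Collapse (p q r : ℕ) : Blocks → Set where
  β-empty : ∀ {α γ} → α + γ ≡ p → Collapse p q r ⟨ α , 0 , γ , q , r ⟩
  γ-empty : ∀ {β δ} → β + δ ≡ q → Collapse p q r ⟨ p , β , 0 , δ , r ⟩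
  δ-empty : ∀ {γ ε} → γ + ε ≡ r → Collapse p q r ⟨ p , q , γ , 0 , ε ⟩

collapse-word : ∀ {p q r x} → Collapse p q r x → word x ≡ W₁₀₁ p q r
collapse-word {q = q} {r} (β-empty {α} {γ} refl) =
  trans (sym (++-assoc (1 ^ʷ α) (1 ^ʷ γ) rest)) (cong (_++ rest) (sym (replicate-+ α γ 1)))
  where rest = (0 ^ʷ q) ++ (1 ^ʷ r)
collapse-word {p} {r = r} (γ-empty {β} {δ} refl) =
  cong ((1 ^ʷ p) ++_) (trans (sym (++-assoc (0 ^ʷ β) (0 ^ʷ δ) (1 ^ʷ r)))
                             (cong (_++ (1 ^ʷ r)) (sym (replicate-+ β δ 0))))
collapse-word {p} {q} (δ-empty {γ} {ε} refl) =
  cong (λ w → (1 ^ʷ p) ++ (0 ^ʷ q) ++ w) (sym (replicate-+ γ ε 1))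

collapse-β≤q : ∀ {p q r x} → Collapse p q r x → Blocks.β x ≤ q
collapse-β≤q (β-empty _)            = z≤n
collapse-β≤q (γ-empty {β} {δ} refl) = m≤m+n β δ
collapse-β≤q (δ-empty _)            = ≤-refl

proper≢collapsed : ∀ {p q r x y} → Proper x → Collapse p q r y → word x ≢ word y
proper≢collapsed {p} {q} {r} px c eq = proper≢W₁₀₁ px p q r (trans eq (collapse-word c))

collapses-agree : ∀ {p q r p′ q′ r′ x y} → Collapse p q r x → Collapse p′ q′ r′ y →
                  1 ≤ Blocks.β x + Blocks.β y → word x ≡ word y → p ≡ p′ × q ≡ q′ × r ≡ r′
collapses-agree c₁ c₂ 1≤β eq =
  W₁₀₁-injective (≤-trans 1≤β (+-mono-≤ (collapse-β≤q c₁) (collapse-β≤q c₂)))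
                 (trans (sym (collapse-word c₁)) (trans eq (collapse-word c₂)))

data Shape (x : Blocks) : Set where
  proper    : Proper x → Shape x
  collapsed : ∀ {p q r} → Collapse p q r x → Shape x

shape : ∀ x → Shape x
shape ⟨ α , zero  , γ     , δ     , ε ⟩ = collapsed (β-empty refl)
shape ⟨ α , suc β , zero  , δ     , ε ⟩ = collapsed (γ-empty refl)
shape ⟨ α , suc β , suc γ , zero  , ε ⟩ = collapsed (δ-empty refl)
shape ⟨ α , suc β , suc γ , suc δ , ε ⟩ = proper proper

n*2≡n+n : ∀ n → n * 2 ≡ n + n
n*2≡n+n n = trans (*-comm n 2) (cong (n +_) (+-identityʳ n))

even-double : ∀ n → Even (n + n)
even-double n = divides n (sym (n*2≡n+n n))

even-halves : ∀ a e γ₁ γ₂ {c} → γ₁ + γ₂ ≡ c → Even (a + c + e) →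
              Even (γ₁ + a) ⇔ Even (γ₂ + e)
even-halves a e γ₁ γ₂ refl ace-even =
  mk⇔ (∣m+n∣m⇒∣n total) (∣m+n∣m⇒∣n (subst Even (+-comm (γ₁ + a) (γ₂ + e)) total))
  where
    regroup : ∀ a γ₁ γ₂ e → a + (γ₁ + γ₂) + e ≡ (γ₁ + a) + (γ₂ + e)
    regroup = solve-∀

    total : Even ((γ₁ + a) + (γ₂ + e))
    total = subst Even (regroup a γ₁ γ₂ e) ace-even

_≤₂_ : ℕ → ℕ → Set
m ≤₂ n = ∃[ k ] n ≡ m + (k + k)

≤₂-refl : ∀ n → n ≤₂ n
≤₂-refl n = 0 , sym (+-identityʳ n)

≤₂⇒even-sum : ∀ {m n} → m ≤₂ n → Even (m + n)
≤₂⇒even-sum {m} (k , refl) = subst Even (regroup m k) (even-double (m + k))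
  where
    regroup : ∀ m k → (m + k) + (m + k) ≡ m + (m + (k + k))
    regroup = solve-∀

≤-even⇒≤₂ : ∀ {m n} → m ≤ n → Even (m + n) → m ≤₂ n
≤-even⇒≤₂ {m} {n} m≤n m+n-even
  with ∣m+n∣m⇒∣n (subst Even m+n≡m+m+[n∸m] m+n-even) (even-double m)
  where
    m+n≡m+m+[n∸m] : m + n ≡ (m + m) + (n ∸ m)
    m+n≡m+m+[n∸m] = trans (cong (m +_) (sym (m+[n∸m]≡n m≤n))) (sym (+-assoc m m (n ∸ m)))
... | divides k n∸m≡k*2 = k , (begin
  n            ≡⟨ m+[n∸m]≡n m≤n ⟨
  m + (n ∸ m)  ≡⟨ cong (m +_) (trans n∸m≡k*2 (n*2≡n+n k)) ⟩
  m + (k + k)  ∎)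
  where open ≡-Reasoning

≤₂-parity : ∀ n → 0 ≤₂ n ⊎ 1 ≤₂ n
≤₂-parity zero = inj₁ (0 , refl)
≤₂-parity (suc n) with ≤₂-parity n
... | inj₁ (k , refl) = inj₂ (k , refl)
... | inj₂ (k , refl) = inj₁ (suc k , cong suc (sym (+-suc k k)))

-- γ₁ = a if c > a; otherwise γ₁ = c, lowered by one when e is odd.
split-middle : ∀ {a c e} → 1 ≤ c → c ≤ a + e → Even (a + c + e) →
               ∃₂ λ γ₁ γ₂ → γ₁ + γ₂ ≡ c × γ₁ ≤₂ a × γ₂ ≤₂ e
split-middle {a} {c@(suc c′)} {e} (s≤s z≤n) c≤a+e ace-even with c ≤? a | ≤₂-parity e
... | no c≰a | _ =
  a , c ∸ a , a+[c∸a]≡c , ≤₂-refl a ,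
  ≤-even⇒≤₂ (m≤n+o⇒m∸n≤o c a c≤a+e)
            (Equivalence.to (even-halves a e a (c ∸ a) a+[c∸a]≡c ace-even) (even-double a))
  where
    a+[c∸a]≡c : a + (c ∸ a) ≡ c
    a+[c∸a]≡c = m+[n∸m]≡n (≰⇒≥ c≰a)
... | yes c≤a | inj₁ 0≤₂e =
  c , 0 , +-identityʳ c ,
  ≤-even⇒≤₂ c≤a (Equivalence.from (even-halves a e c 0 (+-identityʳ c) ace-even)
                                  (≤₂⇒even-sum {0} 0≤₂e)) ,
  0≤₂e
... | yes c≤a | inj₂ 1≤₂e =
  c′ , 1 , +-comm c′ 1 ,
  ≤-even⇒≤₂ (≤-trans (n≤1+n c′) c≤a)
            (Equivalence.from (even-halves a e c′ 1 (+-comm c′ 1) ace-even)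
                              (≤₂⇒even-sum {1} 1≤₂e)) ,
  1≤₂e

Conditions : Blocks → Set
Conditions ⟨ a , b , c , d , e ⟩ =
  (b ≡ d × c ≤ a + e) ⊎ (b ≤ d × a ≥ c × Even e) ⊎ (b ≥ d × c ≤ e × Even a)

conditions-swap : ∀ x y → Conditions (x ⊕ y) → Conditions (y ⊕ x)
conditions-swap x y = subst Conditions (⊕-comm x y)

AllEven : Blocks → Set
AllEven ⟨ a , b , c , d , e ⟩ = Even a × Even b × Even c × Even d × Even e

all-even-double : ∀ {x y} → x ≡ y → AllEven (x ⊕ y)
all-even-double {⟨ α , β , γ , δ , ε ⟩} refl =
  even-double α , even-double β , even-double γ , even-double δ , even-double ε

γ≤α+[α+γ] : ∀ α γ → γ ≤ α + (α + γ)
γ≤α+[α+γ] α γ = m≤n⇒m≤o+n α (m≤n+m γ α)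

β-δ-collapse⇒condition-i : ∀ α γ q γ′ ε →
  Conditions (⟨ α , 0 , γ , q , γ′ + ε ⟩ ⊕ ⟨ α + γ , q , γ′ , 0 , ε ⟩)
β-δ-collapse⇒condition-i α γ q γ′ ε =
  inj₁ (sym (+-identityʳ q) , +-mono-≤ (γ≤α+[α+γ] α γ) (m≤n⇒m≤n+o ε (m≤m+n γ′ ε)))

β-γ-collapse⇒condition-ii : ∀ α γ β δ r →
  Conditions (⟨ α , 0 , γ , β + δ , r ⟩ ⊕ ⟨ α + γ , β , 0 , δ , r ⟩)
β-γ-collapse⇒condition-ii α γ β δ r =
  inj₂ (inj₁ ( m≤n⇒m≤n+o δ (m≤m+n β δ)
             , ≤-trans (≤-reflexive (+-identityʳ γ)) (γ≤α+[α+γ] α γ)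
             , even-double r))

γ-δ-collapse⇒condition-iii : ∀ p β δ γ ε →
  Conditions (⟨ p , β , 0 , δ , γ + ε ⟩ ⊕ ⟨ p , β + δ , γ , 0 , ε ⟩)
γ-δ-collapse⇒condition-iii p β δ γ ε =
  inj₂ (inj₂ ( ≤-trans (≤-reflexive (+-identityʳ δ)) (m≤n⇒m≤o+n β (m≤n+m δ β))
             , m≤n⇒m≤n+o ε (m≤m+n γ ε)
             , even-double p))

collapse-pair⇒conditions : ∀ {p q r x y} → Collapse p q r x → Collapse p q r y →
  1 ≤ Blocks.β (x ⊕ y) → 1 ≤ Blocks.γ (x ⊕ y) → 1 ≤ Blocks.δ (x ⊕ y) → Conditions (x ⊕ y)
collapse-pair⇒conditions (β-empty _) (β-empty _) () _ _
collapse-pair⇒conditions (γ-empty _) (γ-empty _) _ () _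
collapse-pair⇒conditions (δ-empty _) (δ-empty _) _ _ ()
collapse-pair⇒conditions {r = r} (β-empty {α} {γ} refl) (γ-empty {β} {δ} refl) _ _ _ =
  β-γ-collapse⇒condition-ii α γ β δ r
collapse-pair⇒conditions {q = q} (β-empty {α} {γ} refl) (δ-empty {γ′} {ε} refl) _ _ _ =
  β-δ-collapse⇒condition-i α γ q γ′ ε
collapse-pair⇒conditions {p} (γ-empty {β} {δ} refl) (δ-empty {γ} {ε} refl) _ _ _ =
  γ-δ-collapse⇒condition-iii p β δ γ ε
collapse-pair⇒conditions {r = r} (γ-empty {β} {δ} refl) (β-empty {α} {γ} refl) _ _ _ =
  conditions-swap ⟨ α , 0 , γ , β + δ , r ⟩ ⟨ α + γ , β , 0 , δ , r ⟩
    (β-γ-collapse⇒condition-ii α γ β δ r)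
collapse-pair⇒conditions {q = q} (δ-empty {γ′} {ε} refl) (β-empty {α} {γ} refl) _ _ _ =
  conditions-swap ⟨ α , 0 , γ , q , γ′ + ε ⟩ ⟨ α + γ , q , γ′ , 0 , ε ⟩
    (β-δ-collapse⇒condition-i α γ q γ′ ε)
collapse-pair⇒conditions {p} (δ-empty {γ} {ε} refl) (γ-empty {β} {δ} refl) _ _ _ =
  conditions-swap ⟨ p , β , 0 , δ , γ + ε ⟩ ⟨ p , β + δ , γ , 0 , ε ⟩
    (γ-δ-collapse⇒condition-iii p β δ γ ε)

equal-split⇒conditions : ∀ {a b c d e} → EqualSplit ⟨ a , b , c , d , e ⟩ →
  1 ≤ b → 1 ≤ c → 1 ≤ d → ¬ AllEven ⟨ a , b , c , d , e ⟩ → Conditions ⟨ a , b , c , d , e ⟩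
equal-split⇒conditions (x , y , refl , eq) 1≤b 1≤c 1≤d ¬all-even with shape x | shape y
... | proper px | proper py = ⊥-elim (¬all-even (all-even-double (proper-injective px py eq)))
... | proper px | collapsed c = ⊥-elim (proper≢collapsed px c eq)
... | collapsed c | proper py = ⊥-elim (proper≢collapsed py c (sym eq))
... | collapsed c₁ | collapsed c₂ with collapses-agree c₁ c₂ 1≤b eq
... | refl , refl , refl = collapse-pair⇒conditions c₁ c₂ 1≤b 1≤c 1≤d

collapse-pair⇒equal-split : ∀ {p q r s} x y → Collapse p q r x → Collapse p q r y → x ⊕ y ≡ s →
                            EqualSplit s
collapse-pair⇒equal-split x y c₁ c₂ x⊕y≡s =
  x , y , x⊕y≡s , trans (collapse-word c₁) (sym (collapse-word c₂))

k+[k+m]≡m+[k+k] : ∀ k m → k + (k + m) ≡ m + (k + k)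
k+[k+m]≡m+[k+k] k m = trans (sym (+-assoc k k m)) (+-comm (k + k) m)

condition-i⇒equal-split : ∀ {a b c e} → 1 ≤ c → c ≤ a + e → Even (a + c + e) →
                          EqualSplit ⟨ a , b , c , b , e ⟩
condition-i⇒equal-split {a} {b} {c} {e} 1≤c c≤a+e ace-even
  with split-middle {a} {c} {e} 1≤c c≤a+e ace-even
... | γ₁ , γ₂ , refl , (α₁ , refl) , (ε₂ , refl) =
  collapse-pair⇒equal-split ⟨ α₁ , 0 , γ₁ , b , γ₂ + ε₂ ⟩ ⟨ α₁ + γ₁ , b , γ₂ , 0 , ε₂ ⟩
    (β-empty refl) (δ-empty refl)
    (⟨⟩-cong (k+[k+m]≡m+[k+k] α₁ γ₁) refl refl (+-identityʳ b) (+-assoc γ₂ ε₂ ε₂))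

condition-ii⇒equal-split : ∀ {a b c d e} → b ≤ d → c ≤ a → Even e →
                           Even (a + c + e) → Even (b + d) → EqualSplit ⟨ a , b , c , d , e ⟩
condition-ii⇒equal-split {a} {b} {c} {d} {e} b≤d c≤a e-even ace-even bd-even
  with ≤-even⇒≤₂ b≤d bd-even | ≤-even⇒≤₂ c≤a ca-even | ≤-even⇒≤₂ {0} z≤n e-even
  where
    ca-even : Even (c + a)
    ca-even = Equivalence.from (even-halves a e c 0 (+-identityʳ c) ace-even) e-even
... | δ , refl | α , refl | ε , refl =
  collapse-pair⇒equal-split ⟨ α , 0 , c , b + δ , ε ⟩ ⟨ α + c , b , 0 , δ , ε ⟩
    (β-empty refl) (γ-empty refl)
    (⟨⟩-cong (k+[k+m]≡m+[k+k] α c) refl (+-identityʳ c) (+-assoc b δ δ) refl)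

condition-iii⇒equal-split : ∀ {a b c d e} → d ≤ b → c ≤ e → Even a →
                            Even (a + c + e) → Even (b + d) → EqualSplit ⟨ a , b , c , d , e ⟩
condition-iii⇒equal-split {a} {b} {c} {d} {e} d≤b c≤e a-even ace-even bd-even
  with ≤-even⇒≤₂ d≤b (subst Even (+-comm b d) bd-even) | ≤-even⇒≤₂ c≤e ce-even
     | ≤-even⇒≤₂ {0} z≤n a-even
  where
    ce-even : Even (c + e)
    ce-even = Equivalence.to (even-halves a e 0 c refl ace-even) a-even
... | β , refl | ε , refl | α , refl =
  collapse-pair⇒equal-split ⟨ α , β , 0 , d , c + ε ⟩ ⟨ α , β + d , c , 0 , ε ⟩
    (γ-empty refl) (δ-empty refl)
    (⟨⟩-cong refl (k+[k+m]≡m+[k+k] β d) refl (+-identityʳ d) (+-assoc c ε ε))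

conditions⇒equal-split : ∀ {a b c d e} → 1 ≤ c → Even (a + c + e) → Even (b + d) →
                         Conditions ⟨ a , b , c , d , e ⟩ → EqualSplit ⟨ a , b , c , d , e ⟩
conditions⇒equal-split 1≤c ace-even _ (inj₁ (refl , c≤a+e)) =
  condition-i⇒equal-split 1≤c c≤a+e ace-even
conditions⇒equal-split _ ace-even bd-even (inj₂ (inj₁ (b≤d , c≤a , e-even))) =
  condition-ii⇒equal-split b≤d c≤a e-even ace-even bd-even
conditions⇒equal-split _ ace-even bd-even (inj₂ (inj₂ (d≤b , c≤e , a-even))) =
  condition-iii⇒equal-split d≤b c≤e a-even ace-even bd-even

proposition3p3 : (a b c d e : ℕ) → 1 ≤ a → 1 ≤ b → 1 ≤ c → 1 ≤ d → 1 ≤ e →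
    ¬ (Even a × Even b × Even c × Even d × Even e) →
    Even (a + c + e) → Even (b + d) →
    (IsShuffleSquare (W₁₀₁₀₁ a b c d e) ⇔
      ((b ≡ d × c ≤ a + e) ⊎ (b ≤ d × a ≥ c × Even e) ⊎ (b ≥ d × c ≤ e × Even a)))
proposition3p3 a b c d e _ 1≤b 1≤c 1≤d _ ¬all-even ace-even bd-even = mk⇔
  (λ square → equal-split⇒conditions (to square) 1≤b 1≤c 1≤d ¬all-even)
  (λ conditions → from (conditions⇒equal-split 1≤c ace-even bd-even conditions))
  where open Equivalence (shuffle-square⇔equal-split ⟨ a , b , c , d , e ⟩)
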